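{- Consider an execution of the procedure \texttt{search}$(\mathcal{G},T)$ described below. Whenever a region $Z$ with strategy $\sigma$ is computed (for the current subgame $\mathcal{G}'$, top priority $p$ and player $\alpha\equiv p\pmod 2$), from every vertex of $Z$ player $\overline{\alpha}$ can reach a vertex of priority $p$ via a path inside $Z$ that is consistent with $\sigma$.
   Context: Parity games: $\mathcal{G}=(V_0,V_1,E,\mathsf{pr})$ with finite $V=V_0\cup V_1$ (Even owns $V_0$, Odd owns $V_1$), left-total $E\subseteq V\times V$, $\mathsf{pr}:V\to\{0,\dots,d\}$; plays are infinite paths, won by Even iff the highest priority seen infinitely often is even; $\overline{\alpha}$ is the opponent of $\alpha$; strategies are partial functions $\sigma\subseteq E$ on $V_\alpha$. A $p$-tangle is a nonempty $U\subseteq V$ with $p=\max\mathsf{pr}(U)$ and a witness strategy $\sigma_T(U):U\cap V_\alpha\to U$ of player $\alpha\equiv p\pmod 2$ such that $(U, E\cap(\sigma_T(U)\cup((U\cap V_{\overline\alpha})\times U)))$ is strongly connected and all its cycles have highest priority of parity $\alpha$. For a tangle $t$ of $\alpha$, $E_T(t)=\{v\in V\setminus t\mid \exists u\in t\cap V_{\overline\alpha}, (u,v)\in E\}$ (edges taken in the full game $\mathcal{G}$). For $U\subseteq V$, $\mathcal{G}\cap U$ is the subgame induced by $U$, and for a set of tangles $T$, $T\cap U=\{t\in T\mid t\subseteq U\}$. Tangle attractor: for a game $\mathcal{G}'$ with vertices $V'$, a set $T'$ of tangles and $A\subseteq V'$, $\mathit{TAttr}^{\mathcal{G}',T'}_\alpha(A)$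 is the least fixed point $Z$ of $Z=A\cup\{v\in V'_\alpha\mid E(v)\cap Z\ne\emptyset\}\cup\{v\in V'_{\overline\alpha}\mid E(v)\subseteq Z\}\cup\{v\in t\mid t\in T',\ \mathsf{pr}(t)\equiv\alpha \pmod 2,\ E_T(t)\neq\emptyset,\ E_T(t)\subseteq Z\}$ (with edges in $\mathcal{G}'$). It also yields a strategy $\sigma$ of $\alpha$: when an $\alpha$-vertex is added because of a successor in $Z$, $\sigma$ picks that successor; $\alpha$-vertices of $A$ get a successor in $Z$ when the backward search finds one; when the vertices of a tangle $t$ are added (tangles processed one at a time), $\sigma$ is extended by $\{(u,v)\in\sigma_T(t)\mid u\notin\mathrm{dom}(\sigma)\}$. \texttt{extract-tangles}$(Z,\sigma)$: compute the greatest $X\subseteq Z$ with $X=Z\cap(\{v\in V_{\overline\alpha}\mid E'(v)\subseteq X\}\cup\{v\in V_\alpha\mid\sigma(v)\in X\})$, where $E'$ are edges of the current subgame $\mathcal{G}'$; return the set of nontrivial bottom strongly connected components of the graph on $X$ whose edges are all $E'$-edges from $\overline\alpha$-vertices and the $\sigma$-edges from $\alpha$-vertices, each with witness strategy $\sigma$ restricted to it. \texttt{search}$(\mathcal{G},T)$: repeat forever: set the region function $\mathsf{r}:=\emptyset$ (a partial map $V\to\{0,\dots,d\}$) and $Y:=\emptyset$; while $V\setminus\mathrm{dom}(\mathsf{r})\ne\emptyset$: let $\mathcal{G}'=\mathcal{G}\cap(V\setminus\mathrm{dom}(\mathsf{r}))$, $T'=T\cap(V\setminus\mathrm{dom}(\mathsf{r}))$,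 $p$ the highest priority in $\mathcal{G}'$, $\alpha=p\bmod 2$; compute $(Z,\sigma)=\mathit{TAttr}^{\mathcal{G}',T'}_\alpha(\{v\in\mathcal{G}'\mid\mathsf{pr}(v)=p\})$ (the region of priority $p$); $A:=$\texttt{extract-tangles}$(Z,\sigma)$; if some $t\in A$ has $E_T(t)=\emptyset$, return $(T\cup Y,t)$; otherwise set $\mathsf{r}(v):=p$ for all $v\in Z$ and $Y:=Y\cup A$. After the while loop, set $T:=T\cup Y$. -}

module Defs where

open import Data.Nat using (ℕ; zero; suc; _≤_; _⊔_; _≡ᵇ_)
open import Data.Bool using (Bool; true; false; _∧_; if_then_else_)
open import Data.Fin using (Fin; _≟_)
open import Data.Fin.Subset using (Subset; _∈_; _∉_; _⊆_; _∪_; ∁; ⁅_⁆; Nonempty; Empty; ⊥; ⊤)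
open import Data.Fin.Subset.Properties using (_∈?_)
open import Data.Vec using (tabulate)
open import Data.Maybe using (Maybe; just; nothing)
open import Data.List using (List; []; _∷_; _++_; map; foldr)
open import Data.List.Membership.Propositional using () renaming (_∈_ to _∈ₗ_)
open import Data.List.Relation.Unary.Linked using (Linked)
open import Relation.Binary.Construct.Closure.ReflexiveTransitive using (Star)
open import Data.Product using (Σ; ∃; _×_; _,_)
open import Data.Sum using (_⊎_)
open import Relation.Binary.PropositionalEquality using (_≡_)
open import Relation.Nullary using (¬_; does)

data Player : Set where
  even odd : Player

opp : Player → Player
opp even = odd
opp odd  = even

parity : ℕ → Player
parity zero          = even
parity (suc zero)    = odd
parity (suc (suc p)) = parity p

record Game (n : ℕ) : Set where
  field
    owner : Fin n → Player          -- V₀ = owner⁻¹ even, V₁ = owner⁻¹ odd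
    E     : Fin n → Subset n
    pr    : Fin n → ℕ
    total : ∀ v → Nonempty (E v)

Strategy : ℕ → Set
Strategy n = Fin n → Maybe (Fin n)

record Tangle (n : ℕ) : Set where
  constructor mkTangle
  field
    U  : Subset n
    σT : Strategy n
open Tangle public

emptyStrat : ∀ {n} → Strategy n
emptyStrat _ = nothing

update : ∀ {n} → Strategy n → Fin n → Fin n → Strategy n
update σ v w u = if does (u ≟ v) then just w else σ u

extendBy : ∀ {n} → Strategy n → Strategy n → Strategy n
extendBy σ τ u with σ u
... | just w  = just w
... | nothing = τ u

restrict : ∀ {n} → Subset n → Strategy n → Strategy n
restrict C σ u = if does (u ∈? C) then σ u else nothing

module _ {n : ℕ} (G : Game n) where
  open Game G

  IsMaxPr : Subset n → ℕ → Set
  IsMaxPr U p = (∃ λ v → v ∈ U × pr v ≡ p) × (∀ v → v ∈ U → pr v ≤ p)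

  maxPrList : List (Fin n) → ℕ
  maxPrList = foldr (λ v m → pr v ⊔ m) 0

  -- edges of (U, E ∩ (σ ∪ ((U ∩ V_ᾱ) × U)))
  TEdge : Subset n → Player → Strategy n → Fin n → Fin n → Set
  TEdge U α σ u w = u ∈ U × w ∈ U × w ∈ E u × (owner u ≡ α → σ u ≡ just w)

  IsTangle : Tangle n → Set
  IsTangle t = Σ ℕ λ p → IsMaxPr (U t) p ×
    (∀ v → v ∈ U t → owner v ≡ parity p →
       ∃ λ w → σT t v ≡ just w × w ∈ U t × w ∈ E v) ×
    (∀ v → ¬ (v ∈ U t × owner v ≡ parity p) → σT t v ≡ nothing) ×
    (∀ u w → u ∈ U t → w ∈ U t → Star (TEdge (U t) (parity p) (σT t)) u w) ×
    -- every cycle has highest priority of parity α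
    (∀ v vs → Linked (TEdge (U t) (parity p) (σT t)) (v ∷ vs ++ v ∷ []) →
       parity (maxPrList (v ∷ vs)) ≡ parity p)

  TanglePlayer : Tangle n → Player → Set
  TanglePlayer t α = ∃ λ p → IsMaxPr (U t) p × parity p ≡ α

  -- v ∈ E_T(t) for a tangle of α, edges restricted to vertex set W
  -- (W = ⊤ : full game; W = V' : subgame G ∩ V')
  Escape : Subset n → Tangle n → Player → Fin n → Set
  Escape W t α v = v ∈ W × v ∉ U t ×
    ∃ λ u → u ∈ U t × owner u ≡ opp α × v ∈ E u

  topSet : Subset n → ℕ → Subset n
  topSet V' p = tabulate (λ v → does (v ∈? V') ∧ (pr v ≡ᵇ p))

  -- Tangle attractor TAttr^{G ∩ V', T'}_α(A), with its strategy.
  -- T' = T ∩ V' is represented by T together with the side condition U t ⊆ V'.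

  data AttrStep (V' : Subset n) (T : List (Tangle n)) (α : Player) (A : Subset n)
       : Subset n × Strategy n → Subset n × Strategy n → Set where
    attr-α : ∀ {Z σ v w} → v ∈ V' → v ∉ Z → owner v ≡ α → w ∈ Z → w ∈ E v →
             AttrStep V' T α A (Z , σ) (Z ∪ ⁅ v ⁆ , update σ v w)
    attr-ᾱ : ∀ {Z σ v} → v ∈ V' → v ∉ Z → owner v ≡ opp α →
             (∀ w → w ∈ V' → w ∈ E v → w ∈ Z) →
             AttrStep V' T α A (Z , σ) (Z ∪ ⁅ v ⁆ , σ)
    attr-tangle : ∀ {Z σ t} → t ∈ₗ T → U t ⊆ V' → TanglePlayer t α → ¬ (U t ⊆ Z) →
             (∃ λ v → Escape V' t α v) → (∀ v → Escape V' t α v → v ∈ Z) →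
             AttrStep V' T α A (Z , σ) (Z ∪ U t , extendBy σ (σT t))
    -- strategy for α-vertices of A, chosen when the backward search finds a successor in Z
    choose-A : ∀ {Z σ v w} → v ∈ A → owner v ≡ α → σ v ≡ nothing → w ∈ Z → w ∈ V' → w ∈ E v →
             AttrStep V' T α A (Z , σ) (Z , update σ v w)

  Saturated : Subset n → List (Tangle n) → Player → Subset n → Set
  Saturated V' T α Z =
    (∀ v w → v ∈ V' → v ∉ Z → owner v ≡ α → w ∈ Z → ¬ (w ∈ E v)) ×
    (∀ v → v ∈ V' → v ∉ Z → owner v ≡ opp α → ¬ (∀ w → w ∈ V' → w ∈ E v → w ∈ Z)) ×
    (∀ t → t ∈ₗ T → U t ⊆ V' → TanglePlayer t α →
       (∃ λ v → Escape V' t α v) → (∀ v → Escape V' t α v → v ∈ Z) → U t ⊆ Z)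

  TAttr : Subset n → List (Tangle n) → Player → Subset n → Subset n → Strategy n → Set
  TAttr V' T α A Z σ =
    Star (AttrStep V' T α A) (A , emptyStrat) (Z , σ) × Saturated V' T α Z

  PostFix : Subset n → Player → Subset n → Strategy n → Subset n → Set
  PostFix V' α Z σ X = X ⊆ Z × (∀ v → v ∈ X →
    (owner v ≡ opp α → ∀ w → w ∈ V' → w ∈ E v → w ∈ X) ×
    (owner v ≡ α → ∃ λ w → σ v ≡ just w × w ∈ X))

  IsGFP : Subset n → Player → Subset n → Strategy n → Subset n → Set
  IsGFP V' α Z σ X = PostFix V' α Z σ X × (∀ Y → PostFix V' α Z σ Y → Y ⊆ X)

  HEdge : Subset n → Player → Strategy n → Subset n → Fin n → Fin n → Set
  HEdge V' α σ X u w = u ∈ X × w ∈ X ×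
    ((owner u ≡ opp α × w ∈ V' × w ∈ E u) ⊎ (owner u ≡ α × σ u ≡ just w))

  IsBSCC : Subset n → Player → Strategy n → Subset n → Subset n → Set
  IsBSCC V' α σ X C = C ⊆ X × Nonempty C ×
    (∀ u w → u ∈ C → w ∈ C → Star (HEdge V' α σ X) u w) ×
    (∀ u w → u ∈ C → HEdge V' α σ X u w → w ∈ C) ×
    (∃ λ u → ∃ λ w → u ∈ C × w ∈ C × HEdge V' α σ X u w)

  ExtractTangles : Subset n → Player → Subset n → Strategy n → List (Subset n) → Set
  ExtractTangles V' α Z σ Cs = ∃ λ X → IsGFP V' α Z σ X ×
    (∀ C → C ∈ₗ Cs → IsBSCC V' α σ X C) × (∀ C → IsBSCC V' α σ X C → C ∈ₗ Cs)

  asTangles : Strategy n → List (Subset n) → List (Tangle n)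
  asTangles σ = map (λ C → mkTangle C (restrict C σ))

  -- search(G, T): configurations (T, dom r, Y) and its steps

  record Config : Set where
    constructor cfg
    field
      tangles : List (Tangle n)
      domR    : Subset n
      Ynew    : List (Tangle n)

  data SearchStep : Config → Config → Set where
    -- one iteration of the while loop that does not return
    inner : ∀ {T D Y p Z σ Cs} →
      Nonempty (∁ D) →
      IsMaxPr (∁ D) p →
      TAttr (∁ D) T (parity p) (topSet (∁ D) p) Z σ →
      ExtractTangles (∁ D) (parity p) Z σ Cs →
      (∀ t → t ∈ₗ asTangles σ Cs → ∃ λ v → Escape ⊤ t (parity p) v) →
      SearchStep (cfg T D Y) (cfg T (D ∪ Z) (Y ++ asTangles σ Cs))
    -- end of the while loop: T := T ∪ Y, restart with r := ∅, Y := ∅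
    outer : ∀ {T D Y} → Empty (∁ D) →
      SearchStep (cfg T D Y) (cfg (T ++ Y) ⊥ [])

  data ReachTop (Z : Subset n) (α : Player) (σ : Strategy n) (p : ℕ) : Fin n → Set where
    here : ∀ {v} → v ∈ Z → pr v ≡ p → ReachTop Z α σ p v
    step : ∀ {v w} → v ∈ Z → w ∈ Z → w ∈ E v →
           (∀ u → owner v ≡ α → σ v ≡ just u → w ≡ u) →
           ReachTop Z α σ p w → ReachTop Z α σ p v

-- The region Z is built backwards from the vertices of priority p, and every vertex added to it
-- gets a σ-consistent path into the part of Z built before: an α-vertex through the successor
-- chosen for it, an ᾱ-vertex through any of its successors in the subgame (all of them already lie
-- in Z, and one exists because the subgame is total), and a tangle t through the strongly connected
-- graph of its witness strategy, towards an ᾱ-vertex of t with an escape edge into Z.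
--
-- So it suffices that throughout search every tangle in T is strongly connected with a total
-- witness strategy, and that the current subgame is total. Input tangles are. An extracted tangle
-- is a bottom SCC C of the σ-graph of a region Z of priority p; σ-consistent paths from C stay in C,
-- so C contains a vertex of priority p, the top priority of the subgame, and its own tangle player
-- is therefore α, the player of σ. Totality survives removing a region, since the complement of
-- an attractor is a trap.

module Submission where

open import Defs
open import Data.Nat using (ℕ; _≤_)
open import Data.Nat.Properties using (≤-antisym; ≡ᵇ⇒≡)
import Data.Nat.Properties as ℕ
open import Data.Fin using (_≟_)
open import Data.Fin.Properties using (any?)
open import Data.Fin.Subset using (Subset; _∈_; _∉_; _⊆_; _∪_; ∁; ⁅_⁆; Nonempty; ⊥)
open import Data.Fin.Subset.Properties
  using (_∈?_; x∈⁅x⁆; x∈⁅y⁆⇒x≡y; x∈∁p⇒x∉p; x∉p⇒x∈∁p; x∈p∪q⁻; p⊆p∪q; q⊆p∪q; p⊆q⇒∁p⊇∁q; ∉⊥)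
open import Data.Vec.Properties using ([]=⇒lookup; lookup∘tabulate)
open import Data.Bool.Properties using (T-≡)
open import Data.Maybe using (just; nothing)
open import Data.Maybe.Properties using (just-injective)
open import Data.List using (List; [])
open import Data.List.Relation.Unary.All using (All; [])
import Data.List.Relation.Unary.All as All
open import Data.List.Relation.Unary.All.Properties using (++⁺; map⁺)
open import Relation.Binary.Core using (Rel)
open import Relation.Binary.Construct.Closure.ReflexiveTransitive using (Star; ε; _◅_; fold)
open import Data.Product using (∃; _×_; _,_; proj₁; proj₂; uncurry)
open import Data.Sum using (_⊎_; inj₁; inj₂; [_,_]; map₂)
open import Data.Empty using (⊥-elim)
open import Function using (_∘_; id)
open import Function.Bundles using (Equivalence)
open import Relation.Binary.PropositionalEquality using (_≡_; _≢_; refl; sym; trans; subst)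
open import Relation.Nullary using (yes; no; contradiction)
open import Relation.Nullary.Decidable using (dec-true; dec-false; decidable-stable; _×-dec_; ¬?)

Star-preserves : ∀ {a r i} {A : Set a} {R : Rel A r} (I : A → Set i) →
  (∀ {x y} → R x y → I x → I y) → ∀ {x y} → Star R x y → I x → I y
Star-preserves I preserve = fold (λ x y → I x → I y) (λ r f → f ∘ preserve r) id

≡opp⇒≢ : ∀ {a α} → a ≡ opp α → a ≢ α
≡opp⇒≢ {α = even} refl ()
≡opp⇒≢ {α = odd}  refl ()

≡⊎≡opp : ∀ a α → a ≡ α ⊎ a ≡ opp α
≡⊎≡opp even even = inj₁ refl
≡⊎≡opp even odd  = inj₂ refl
≡⊎≡opp odd  even = inj₂ refl
≡⊎≡opp odd  odd  = inj₁ refl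

x∈p∪⁅y⁆⁻ : ∀ {n} {p : Subset n} {x y} → x ∈ p ∪ ⁅ y ⁆ → x ∈ p ⊎ x ≡ y
x∈p∪⁅y⁆⁻ {p = p} {y = y} = map₂ (x∈⁅y⁆⇒x≡y y) ∘ x∈p∪q⁻ p ⁅ y ⁆

x∈∁p∪q⁻ : ∀ {n} {p q : Subset n} {x} → x ∈ ∁ (p ∪ q) → x ∈ ∁ p × x ∉ q
x∈∁p∪q⁻ {p = p} {q} x∈ = p⊆q⇒∁p⊇∁q (p⊆p∪q q) x∈ , x∈∁p⇒x∉p x∈ ∘ q⊆p∪q p q

x∈∁p∪q⁺ : ∀ {n} {p q : Subset n} {x} → x ∈ ∁ p → x ∉ q → x ∈ ∁ (p ∪ q)
x∈∁p∪q⁺ {p = p} {q} x∈∁p x∉q = x∉p⇒x∈∁p ([ x∈∁p⇒x∉p x∈∁p , x∉q ] ∘ x∈p∪q⁻ p q)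

module _ {n : ℕ} where

  update-same : ∀ (σ : Strategy n) v w → update σ v w v ≡ just w
  update-same σ v w rewrite dec-true (v ≟ v) refl = refl

  update-other : ∀ (σ : Strategy n) {v} w {x} → x ≢ v → update σ v w x ≡ σ x
  update-other σ {v} w {x} x≢v rewrite dec-false (x ≟ v) x≢v = refl

  extendBy-just : ∀ (σ τ : Strategy n) {x u} → σ x ≡ just u → extendBy σ τ x ≡ just u
  extendBy-just σ τ {x} eq with σ x
  extendBy-just σ τ refl | just _ = refl

  extendBy-nothing : ∀ (σ τ : Strategy n) {x} → σ x ≡ nothing → extendBy σ τ x ≡ τ x
  extendBy-nothing σ τ {x} eq with σ x
  extendBy-nothing σ τ refl | nothing = refl

  extendBy-inv : ∀ (σ τ : Strategy n) {x u} → extendBy σ τ x ≡ just u → σ x ≡ just u ⊎ τ x ≡ just u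
  extendBy-inv σ τ {x} eq with σ x
  ... | just _  = inj₁ eq
  ... | nothing = inj₂ eq

  restrict-∈ : ∀ C (σ : Strategy n) {u} → u ∈ C → restrict C σ u ≡ σ u
  restrict-∈ C σ {u} u∈C rewrite dec-true (u ∈? C) u∈C = refl

  restrict-∉ : ∀ C (σ : Strategy n) {u} → u ∉ C → restrict C σ u ≡ nothing
  restrict-∉ C σ {u} u∉C rewrite dec-false (u ∈? C) u∉C = refl

  restrict-inv : ∀ C (σ : Strategy n) {u w} → restrict C σ u ≡ just w → σ u ≡ just w
  restrict-inv C σ {u} eq with u ∈? C
  ... | yes _ = eq

module _ {n : ℕ} (G : Game n) where
  open Game G

  topSet-mem : ∀ {V' p v} → v ∈ topSet G V' p → v ∈ V' × pr v ≡ p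
  topSet-mem {V'} {p} {v} v∈top
    with v ∈? V' | trans (sym (lookup∘tabulate _ v)) ([]=⇒lookup v∈top)
  ... | yes v∈V' | pr≡p = v∈V' , ≡ᵇ⇒≡ (pr v) p (Equivalence.from T-≡ pr≡p)

  IsMaxPr-unique : ∀ {S p q} → IsMaxPr G S p → IsMaxPr G S q → p ≡ q
  IsMaxPr-unique ((a , a∈S , pra) , ≤p) ((b , b∈S , prb) , ≤q) =
    ≤-antisym (subst (_≤ _) pra (≤q a a∈S)) (subst (_≤ _) prb (≤p b b∈S))

  Total : Subset n → Set
  Total V' = ∀ v → v ∈ V' → ∃ λ w → w ∈ V' × w ∈ E v

  Total-∁⊥ : Total (∁ ⊥)
  Total-∁⊥ v _ = let w , w∈Ev = total v in w , x∉p⇒x∈∁p ∉⊥ , w∈Ev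

  Saturated⇒Total-∁∪ : ∀ {D T α Z} → Total (∁ D) → Saturated G (∁ D) T α Z → Total (∁ (D ∪ Z))
  Saturated⇒Total-∁∪ {D} {T} {α} {Z} total-D (no-α-entry , no-ᾱ-entry , _) v v∈∁D∪Z =
    exit (≡⊎≡opp (owner v) α)
    where
    v∈∁D : v ∈ ∁ D
    v∈∁D = proj₁ (x∈∁p∪q⁻ v∈∁D∪Z)
    v∉Z : v ∉ Z
    v∉Z = proj₂ (x∈∁p∪q⁻ v∈∁D∪Z)
    exit : owner v ≡ α ⊎ owner v ≡ opp α → ∃ λ w → w ∈ ∁ (D ∪ Z) × w ∈ E v
    exit (inj₁ o) =
      let w , w∈∁D , w∈Ev = total-D v v∈∁D in
      w , x∈∁p∪q⁺ w∈∁D (λ w∈Z → no-α-entry v w v∈∁D v∉Z o w∈Z w∈Ev) , w∈Ev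
    exit (inj₂ o) with any? (λ w → (w ∈? ∁ D) ×-dec (w ∈? E v) ×-dec ¬? (w ∈? Z))
    ... | yes (w , w∈∁D , w∈Ev , w∉Z) = w , x∈∁p∪q⁺ w∈∁D w∉Z , w∈Ev
    ... | no ∄exit = contradiction forced (no-ᾱ-entry v v∈∁D v∉Z o)
      where
      forced : ∀ w → w ∈ ∁ D → w ∈ E v → w ∈ Z
      forced w w∈∁D w∈Ev = decidable-stable (w ∈? Z) (λ w∉Z → ∄exit (w , w∈∁D , w∈Ev , w∉Z))

  record IsWeakTangle (t : Tangle n) : Set where
    field
      σT-outside : ∀ v → v ∉ U t → σT t v ≡ nothing
      σT-edge    : ∀ v w → σT t v ≡ just w → w ∈ E v
      σT-total   : ∀ {q} → IsMaxPr G (U t) q →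
                   ∀ v → v ∈ U t → owner v ≡ parity q → ∃ λ w → σT t v ≡ just w
      connected  : ∀ {q} → IsMaxPr G (U t) q →
                   ∀ u w → u ∈ U t → w ∈ U t → Star (TEdge G (U t) (parity q) (σT t)) u w

  IsTangle⇒IsWeakTangle : ∀ {t} → IsTangle G t → IsWeakTangle t
  IsTangle⇒IsWeakTangle {t} (p , max-p , σT-defined , σT-undefined , strongly-connected , _) = record
    { σT-outside = λ v v∉U → σT-undefined v (v∉U ∘ proj₁)
    ; σT-edge    = σT-edge
    ; σT-total   = σT-total ∘ IsMaxPr-unique max-p
    ; connected  = connected ∘ IsMaxPr-unique max-p
    }
    where
    σT-total : ∀ {q} → p ≡ q → ∀ v → v ∈ U t → owner v ≡ parity q → ∃ λ w → σT t v ≡ just w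
    σT-total refl v v∈U α-v = let w , eq , _ = σT-defined v v∈U α-v in w , eq
    connected : ∀ {q} → p ≡ q → ∀ u w → u ∈ U t → w ∈ U t → Star (TEdge G (U t) (parity q) (σT t)) u w
    connected refl = strongly-connected
    σT-edge : ∀ v w → σT t v ≡ just w → w ∈ E v
    σT-edge v w eq with v ∈? U t | ≡⊎≡opp (owner v) (parity p)
    ... | yes v∈U | inj₁ o = let w' , eq' , _ , w'∈Ev = σT-defined v v∈U o in
                             subst (_∈ E v) (just-injective (trans (sym eq') eq)) w'∈Ev
    ... | yes _   | inj₂ o = contradiction (trans (sym eq) (σT-undefined v (≡opp⇒≢ o ∘ proj₂))) λ ()
    ... | no v∉U  | _      = contradiction (trans (sym eq) (σT-undefined v (v∉U ∘ proj₁))) λ ()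

  ReachTop-mono : ∀ {Z Z' α σ σ' p} → Z ⊆ Z' →
    (∀ y → y ∈ Z → owner y ≡ α → pr y ≢ p → σ' y ≡ σ y) →
    ∀ {x} → ReachTop G Z α σ p x → ReachTop G Z' α σ' p x
  ReachTop-mono Z⊆Z' agree (here x∈Z pr≡p) = here (Z⊆Z' x∈Z) pr≡p
  ReachTop-mono {p = p} Z⊆Z' agree (step {v} v∈Z w∈Z w∈Ev follows r) with pr v ℕ.≟ p
  ... | yes pr≡p = here (Z⊆Z' v∈Z) pr≡p
  ... | no pr≢p  = step (Z⊆Z' v∈Z) (Z⊆Z' w∈Z) w∈Ev
                     (λ u o eq → follows u o (trans (sym (agree v v∈Z o pr≢p)) eq))
                     (ReachTop-mono Z⊆Z' agree r)

  record AttrInv (V' : Subset n) (p : ℕ) (Z : Subset n) (σ : Strategy n) : Set where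
    field
      Z⊆V'      : Z ⊆ V'
      top⊆Z     : topSet G V' p ⊆ Z
      σ-outside : ∀ v → v ∉ Z → σ v ≡ nothing
      σ-edge    : ∀ v w → σ v ≡ just w → w ∈ E v
      σ-total   : ∀ v → v ∈ Z → owner v ≡ parity p → pr v ≢ p → ∃ λ w → σ v ≡ just w
      reach     : ∀ v → v ∈ Z → ReachTop G Z (parity p) σ p v

  update-edge : ∀ {σ v w} → (∀ x u → σ x ≡ just u → u ∈ E x) → w ∈ E v →
    ∀ x u → update σ v w x ≡ just u → u ∈ E x
  update-edge {σ} {v} {w} σ-edge w∈Ev x u eq with x ≟ v
  ... | yes refl = subst (_∈ E x) (just-injective eq) w∈Ev
  ... | no _     = σ-edge x u eq

  module _ {V' : Subset n} {p : ℕ} where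

    AttrInv-init : AttrInv V' p (topSet G V' p) emptyStrat
    AttrInv-init = record
      { Z⊆V'      = proj₁ ∘ topSet-mem
      ; top⊆Z     = id
      ; σ-outside = λ _ _ → refl
      ; σ-edge    = λ _ _ ()
      ; σ-total   = λ v v∈top _ pr≢p → contradiction (proj₂ (topSet-mem v∈top)) pr≢p
      ; reach     = λ v v∈top → here v∈top (proj₂ (topSet-mem v∈top))
      }

    AttrInv-add-α : ∀ {Z σ v w} → v ∈ V' → v ∉ Z → w ∈ Z → w ∈ E v →
      AttrInv V' p Z σ → AttrInv V' p (Z ∪ ⁅ v ⁆) (update σ v w)
    AttrInv-add-α {Z} {σ} {v} {w} v∈V' v∉Z w∈Z w∈Ev I = record
      { Z⊆V'      = [ Z⊆V' , (λ { refl → v∈V' }) ] ∘ x∈p∪⁅y⁆⁻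
      ; top⊆Z     = grow ∘ top⊆Z
      ; σ-outside = λ x x∉Z' → trans (update-other σ w (x∉Z' ∘ λ { refl → new })) (σ-outside x (x∉Z' ∘ grow))
      ; σ-edge    = update-edge σ-edge w∈Ev
      ; σ-total   = total'
      ; reach     = reach'
      }
      where
      open AttrInv I
      grow : Z ⊆ Z ∪ ⁅ v ⁆
      grow = p⊆p∪q ⁅ v ⁆
      new : v ∈ Z ∪ ⁅ v ⁆
      new = q⊆p∪q Z ⁅ v ⁆ (x∈⁅x⁆ v)
      agree : ∀ y → y ∈ Z → owner y ≡ parity p → pr y ≢ p → update σ v w y ≡ σ y
      agree y y∈Z _ _ = update-other σ w λ { refl → v∉Z y∈Z }
      total' : ∀ x → x ∈ Z ∪ ⁅ v ⁆ → owner x ≡ parity p → pr x ≢ p → ∃ λ u → update σ v w x ≡ just u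
      total' x x∈Z' o pr≢p with x∈p∪⁅y⁆⁻ x∈Z'
      ... | inj₁ x∈Z  = let u , eq = σ-total x x∈Z o pr≢p in u , trans (agree x x∈Z o pr≢p) eq
      ... | inj₂ refl = w , update-same σ v w
      reach' : ∀ x → x ∈ Z ∪ ⁅ v ⁆ → ReachTop G (Z ∪ ⁅ v ⁆) (parity p) (update σ v w) p x
      reach' x x∈Z' with x∈p∪⁅y⁆⁻ x∈Z'
      ... | inj₁ x∈Z  = ReachTop-mono grow agree (reach x x∈Z)
      ... | inj₂ refl = step new (grow w∈Z) w∈Ev
                          (λ _ _ eq → just-injective (trans (sym (update-same σ v w)) eq))
                          (ReachTop-mono grow agree (reach w w∈Z))

    AttrInv-add-ᾱ : ∀ {Z σ v} → Total V' → v ∈ V' → v ∉ Z → owner v ≡ opp (parity p) →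
      (∀ w → w ∈ V' → w ∈ E v → w ∈ Z) → AttrInv V' p Z σ → AttrInv V' p (Z ∪ ⁅ v ⁆) σ
    AttrInv-add-ᾱ {Z} {σ} {v} total-V' v∈V' v∉Z ᾱ-v forced I = record
      { Z⊆V'      = [ Z⊆V' , (λ { refl → v∈V' }) ] ∘ x∈p∪⁅y⁆⁻
      ; top⊆Z     = grow ∘ top⊆Z
      ; σ-outside = λ x x∉Z' → σ-outside x (x∉Z' ∘ grow)
      ; σ-edge    = σ-edge
      ; σ-total   = total'
      ; reach     = reach'
      }
      where
      open AttrInv I
      grow : Z ⊆ Z ∪ ⁅ v ⁆
      grow = p⊆p∪q ⁅ v ⁆
      total' : ∀ x → x ∈ Z ∪ ⁅ v ⁆ → owner x ≡ parity p → pr x ≢ p → ∃ λ u → σ x ≡ just u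
      total' x x∈Z' o pr≢p with x∈p∪⁅y⁆⁻ x∈Z'
      ... | inj₁ x∈Z  = σ-total x x∈Z o pr≢p
      ... | inj₂ refl = contradiction o (≡opp⇒≢ ᾱ-v)
      reach' : ∀ x → x ∈ Z ∪ ⁅ v ⁆ → ReachTop G (Z ∪ ⁅ v ⁆) (parity p) σ p x
      reach' x x∈Z' with x∈p∪⁅y⁆⁻ x∈Z'
      ... | inj₁ x∈Z  = ReachTop-mono grow (λ _ _ _ _ → refl) (reach x x∈Z)
      ... | inj₂ refl =
        let w , w∈V' , w∈Ev = total-V' v v∈V'
            w∈Z = forced w w∈V' w∈Ev
        in step x∈Z' (grow w∈Z) w∈Ev (λ _ o _ → contradiction o (≡opp⇒≢ ᾱ-v))
                (ReachTop-mono grow (λ _ _ _ _ → refl) (reach w w∈Z))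

    AttrInv-add-tangle : ∀ {Z σ t} → IsWeakTangle t → U t ⊆ V' → TanglePlayer G t (parity p) →
      (∃ λ v → Escape G V' t (parity p) v) → (∀ v → Escape G V' t (parity p) v → v ∈ Z) →
      AttrInv V' p Z σ → AttrInv V' p (Z ∪ U t) (extendBy σ (σT t))
    AttrInv-add-tangle {Z} {σ} {t} W U⊆V' (q , max-q , q≡α)
                       (e , e-escape@(_ , _ , u₀ , u₀∈U , ᾱ-u₀ , e∈Eu₀)) escapes⊆Z I = record
      { Z⊆V'      = [ Z⊆V' , U⊆V' ] ∘ x∈p∪q⁻ Z (U t)
      ; top⊆Z     = grow ∘ top⊆Z
      ; σ-outside = λ x x∉Z' → trans (extendBy-nothing σ (σT t) (σ-outside x (x∉Z' ∘ grow)))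
                                      (σT-outside x (x∉Z' ∘ growU))
      ; σ-edge    = λ x u eq → [ σ-edge x u , σT-edge x u ] (extendBy-inv σ (σT t) eq)
      ; σ-total   = total'
      ; reach     = reach'
      }
      where
      open AttrInv I
      open IsWeakTangle W
      σ' : Strategy n
      σ' = extendBy σ (σT t)
      grow : Z ⊆ Z ∪ U t
      grow = p⊆p∪q (U t)
      growU : U t ⊆ Z ∪ U t
      growU = q⊆p∪q Z (U t)
      agree : ∀ y → y ∈ Z → owner y ≡ parity p → pr y ≢ p → σ' y ≡ σ y
      agree y y∈Z o pr≢p = let _ , eq = σ-total y y∈Z o pr≢p in trans (extendBy-just σ (σT t) eq) (sym eq)
      fresh : ∀ {x} → x ∉ Z → σ' x ≡ σT t x
      fresh {x} x∉Z = extendBy-nothing σ (σT t) (σ-outside x x∉Z)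
      total' : ∀ x → x ∈ Z ∪ U t → owner x ≡ parity p → pr x ≢ p → ∃ λ u → σ' x ≡ just u
      total' x x∈Z' o pr≢p with x ∈? Z
      ... | yes x∈Z = let u , eq = σ-total x x∈Z o pr≢p in u , trans (agree x x∈Z o pr≢p) eq
      ... | no x∉Z  = let x∈U = [ ⊥-elim ∘ x∉Z , id ] (x∈p∪q⁻ Z (U t) x∈Z')
                          u , eq = σT-total max-q x x∈U (trans o (sym q≡α))
                      in u , trans (fresh x∉Z) eq
      e∈Z : e ∈ Z
      e∈Z = escapes⊆Z e e-escape
      old : ∀ {x} → x ∈ Z → ReachTop G (Z ∪ U t) (parity p) σ' p x
      old x∈Z = ReachTop-mono grow agree (reach _ x∈Z)
      walk : ∀ {x} → x ∈ U t → Star (TEdge G (U t) (parity q) (σT t)) x u₀ →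
             ReachTop G (Z ∪ U t) (parity p) σ' p x
      walk {x} x∈U path with x ∈? Z
      ... | yes x∈Z = old x∈Z
      walk x∈U ε | no _ =
        step (growU x∈U) (grow e∈Z) e∈Eu₀ (λ _ o _ → contradiction o (≡opp⇒≢ ᾱ-u₀)) (old e∈Z)
      walk x∈U ((_ , y∈U , y∈Ex , follows) ◅ path) | no x∉Z =
        step (growU x∈U) (growU y∈U) y∈Ex
             (λ _ o eq → just-injective (trans (sym (trans (fresh x∉Z) (follows (trans o (sym q≡α))))) eq))
             (walk y∈U path)
      reach' : ∀ x → x ∈ Z ∪ U t → ReachTop G (Z ∪ U t) (parity p) σ' p x
      reach' x x∈Z' = [ old , (λ x∈U → walk x∈U (connected max-q x u₀ x∈U u₀∈U)) ] (x∈p∪q⁻ Z (U t) x∈Z')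

    AttrInv-choose : ∀ {Z σ v w} → v ∈ topSet G V' p → w ∈ E v →
      AttrInv V' p Z σ → AttrInv V' p Z (update σ v w)
    AttrInv-choose {Z} {σ} {v} {w} v∈top w∈Ev I = record
      { Z⊆V'      = Z⊆V'
      ; top⊆Z     = top⊆Z
      ; σ-outside = λ x x∉Z → trans (update-other σ w λ { refl → x∉Z (top⊆Z v∈top) }) (σ-outside x x∉Z)
      ; σ-edge    = update-edge σ-edge w∈Ev
      ; σ-total   = λ x x∈Z o pr≢p → let u , eq = σ-total x x∈Z o pr≢p in u , trans (agree x x∈Z o pr≢p) eq
      ; reach     = λ x x∈Z → ReachTop-mono id agree (reach x x∈Z)
      }
      where
      open AttrInv I
      agree : ∀ y → y ∈ Z → owner y ≡ parity p → pr y ≢ p → update σ v w y ≡ σ y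
      agree y _ _ pr≢p = update-other σ w λ { refl → pr≢p (proj₂ (topSet-mem v∈top)) }

    AttrInv-step : ∀ {T s s'} → All IsWeakTangle T → Total V' →
      AttrStep G V' T (parity p) (topSet G V' p) s s' → uncurry (AttrInv V' p) s → uncurry (AttrInv V' p) s'
    AttrInv-step _ _ (attr-α v∈V' v∉Z _ w∈Z w∈Ev) = AttrInv-add-α v∈V' v∉Z w∈Z w∈Ev
    AttrInv-step _ total-V' (attr-ᾱ v∈V' v∉Z ᾱ-v forced) = AttrInv-add-ᾱ total-V' v∈V' v∉Z ᾱ-v forced
    AttrInv-step weakT _ (attr-tangle t∈T U⊆V' player _ escape escapes⊆Z) =
      AttrInv-add-tangle (All.lookup weakT t∈T) U⊆V' player escape escapes⊆Z
    AttrInv-step _ _ (choose-A v∈top _ _ _ _ w∈Ev) = AttrInv-choose v∈top w∈Ev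

    TAttr⇒AttrInv : ∀ {T Z σ} → All IsWeakTangle T → Total V' →
      TAttr G V' T (parity p) (topSet G V' p) Z σ → AttrInv V' p Z σ
    TAttr⇒AttrInv weakT total-V' (run , _) =
      Star-preserves (uncurry (AttrInv V' p)) (AttrInv-step weakT total-V') run AttrInv-init

  module _ {V' : Subset n} {p : ℕ} {Z : Subset n} {σ : Strategy n} {X : Subset n}
           (I : AttrInv V' p Z σ) where
    open AttrInv I

    HEdge⇒edge : ∀ {u w} → HEdge G V' (parity p) σ X u w → w ∈ E u
    HEdge⇒edge (_ , _ , inj₁ (_ , _ , w∈Eu)) = w∈Eu
    HEdge⇒edge (_ , _ , inj₂ (_ , σu≡w))     = σ-edge _ _ σu≡w

    HEdge⇒follows : ∀ {u w} → HEdge G V' (parity p) σ X u w → owner u ≡ parity p → σ u ≡ just w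
    HEdge⇒follows (_ , _ , inj₁ (ᾱ-u , _)) o = contradiction o (≡opp⇒≢ ᾱ-u)
    HEdge⇒follows (_ , _ , inj₂ (_ , σu≡w)) _ = σu≡w

    PostFix⇒HEdge : PostFix G V' (parity p) Z σ X → ∀ {x w} → x ∈ X → w ∈ Z → w ∈ E x →
      (∀ u → owner x ≡ parity p → σ x ≡ just u → w ≡ u) → HEdge G V' (parity p) σ X x w
    PostFix⇒HEdge (_ , X-closed) {x} {w} x∈X w∈Z w∈Ex follows with ≡⊎≡opp (owner x) (parity p)
    ... | inj₂ ᾱ-x = x∈X , proj₁ (X-closed x x∈X) ᾱ-x w (Z⊆V' w∈Z) w∈Ex , inj₁ (ᾱ-x , Z⊆V' w∈Z , w∈Ex)
    ... | inj₁ α-x with proj₂ (X-closed x x∈X) α-x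
    ...   | u , σx≡u , u∈X with follows u α-x σx≡u
    ...     | refl = x∈X , u∈X , inj₂ (α-x , σx≡u)

    -- A σ-consistent path to priority p cannot leave a set closed under the σ-graph on X.
    closed-contains-top : PostFix G V' (parity p) Z σ X → ∀ {C} → C ⊆ X →
      (∀ u w → u ∈ C → HEdge G V' (parity p) σ X u w → w ∈ C) →
      ∀ {x} → x ∈ C → ∃ λ y → y ∈ C × pr y ≡ p
    closed-contains-top X-post {C} C⊆X C-closed {x} x∈C = go (reach x (proj₁ X-post (C⊆X x∈C))) x∈C
      where
      go : ∀ {x} → ReachTop G Z (parity p) σ p x → x ∈ C → ∃ λ y → y ∈ C × pr y ≡ p
      go (here _ pr≡p) x∈C = _ , x∈C , pr≡p
      go (step _ w∈Z w∈Ex follows r) x∈C =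
        go r (C-closed _ _ x∈C (PostFix⇒HEdge X-post (C⊆X x∈C) w∈Z w∈Ex follows))

    bscc-isWeakTangle : IsMaxPr G V' p → PostFix G V' (parity p) Z σ X → ∀ {C} →
      IsBSCC G V' (parity p) σ X C → IsWeakTangle (mkTangle C (restrict C σ))
    bscc-isWeakTangle max-p X-post {C} (C⊆X , (c , c∈C) , C-connected , C-closed , _) = record
      { σT-outside = λ v v∉C → restrict-∉ C σ v∉C
      ; σT-edge    = λ v w eq → σ-edge v w (restrict-inv C σ eq)
      ; σT-total   = σT-total ∘ maxPr≡p
      ; connected  = connected ∘ maxPr≡p
      }
      where
      maxPr≡p : ∀ {q} → IsMaxPr G C q → q ≡ p
      maxPr≡p ((c' , c'∈C , pr≡q) , ≤q) =
        let y , y∈C , pr≡p = closed-contains-top X-post C⊆X C-closed c∈C in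
        ≤-antisym (subst (_≤ p) pr≡q (proj₂ max-p c' (Z⊆V' (proj₁ X-post (C⊆X c'∈C)))))
                  (subst (_≤ _) pr≡p (≤q y y∈C))
      σT-total : ∀ {q} → q ≡ p → ∀ v → v ∈ C → owner v ≡ parity q → ∃ λ w → restrict C σ v ≡ just w
      σT-total refl v v∈C α-v =
        let w , σv≡w , _ = proj₂ (proj₂ X-post v (C⊆X v∈C)) α-v in w , trans (restrict-∈ C σ v∈C) σv≡w
      restrict-path : ∀ {u w} → u ∈ C → Star (HEdge G V' (parity p) σ X) u w →
                      Star (TEdge G C (parity p) (restrict C σ)) u w
      restrict-path u∈C ε = ε
      restrict-path u∈C (uw ◅ path) =
        let w∈C = C-closed _ _ u∈C uw in
        (u∈C , w∈C , HEdge⇒edge uw , trans (restrict-∈ C σ u∈C) ∘ HEdge⇒follows uw) ◅ restrict-path w∈C path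
      connected : ∀ {q} → q ≡ p → ∀ u w → u ∈ C → w ∈ C → Star (TEdge G C (parity q) (restrict C σ)) u w
      connected refl u w u∈C w∈C = restrict-path u∈C (C-connected u w u∈C w∈C)

  SearchInv : Config G → Set
  SearchInv (cfg T D Y) = All IsWeakTangle T × All IsWeakTangle Y × Total (∁ D)

  SearchInv-step : ∀ {c c'} → SearchStep G c c' → SearchInv c → SearchInv c'
  SearchInv-step (inner {D = D} {p = p} {Z} {σ} _ max-p attr (X , (X-post , _) , Cs-bscc , _) _)
                 (weakT , weakY , total-D) =
    weakT ,
    ++⁺ weakY (map⁺ (All.tabulate λ C∈Cs → bscc-isWeakTangle I max-p X-post (Cs-bscc _ C∈Cs))) ,
    Saturated⇒Total-∁∪ total-D (proj₂ attr)
    where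
    I : AttrInv (∁ D) p Z σ
    I = TAttr⇒AttrInv weakT total-D attr
  SearchInv-step (outer _) (weakT , weakY , _) = ++⁺ weakT weakY , [] , Total-∁⊥

lemma3 : ∀ {n} (G : Game n) (T₀ : List (Tangle n)) → All (IsTangle G) T₀ →
    ∀ T D Y → Star (SearchStep G) (cfg T₀ ⊥ []) (cfg T D Y) →
    Nonempty (∁ D) →
    ∀ p → IsMaxPr G (∁ D) p →
    ∀ Z σ → TAttr G (∁ D) T (parity p) (topSet G (∁ D) p) Z σ →
    ∀ v → v ∈ Z → ReachTop G Z (parity p) σ p v
lemma3 G T₀ T₀-tangles T D Y run _ p _ Z σ attr
  with Star-preserves (SearchInv G) (SearchInv-step G) run
         (All.map (IsTangle⇒IsWeakTangle G) T₀-tangles , [] , Total-∁⊥ G)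
... | weakT , _ , total-D = AttrInv.reach (TAttr⇒AttrInv G weakT total-D attr)
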